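{- Let $n$ and $m$ be positive integers with $m\geq n+1$. There is a bijection from $\tilde{\mathcal{L}}_{n,m,0}$ onto $\mathcal{L}_{n,m,1}$.
   Context: An $(n,m)$-lattice path is a sequence $P=(x_1,y_1)(x_2,y_2)\cdots(x_{n+1},y_{n+1})$ of vectors in $\mathbb{Z}^2$ such that $1-n\leq y_i\leq 1$ for all $i$, $\sum_{i=1}^{n+1}y_i=1$, $1\leq x_i\leq m-1$ for all $i$, and $\sum_{i=1}^{n+1}x_i=m$. For such $P$, let $NP(P)=\{i\in\{1,\ldots,n+1\}\mid \sum_{j=1}^{i}y_j\leq 0\}$, and define the non-positive length $NPL(P)=\sum_{i\in NP(P)}x_i$. For an integer $r$, $\mathcal{L}_{n,m,r}$ denotes the set of all $(n,m)$-lattice paths $P$ with $NPL(P)=r$, and $\tilde{\mathcal{L}}_{n,m,0}$ denotes the set of all $P=(x_1,y_1)\cdots(x_{n+1},y_{n+1})\in\mathcal{L}_{n,m,0}$ with $x_{n+1}=1$. -}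

module Defs where

open import Data.Nat using (ℕ)
open import Data.Integer using (ℤ; +_; _+_; _-_; _≤_; _≤?_; 0ℤ; 1ℤ)
open import Data.Product using (Σ; _×_; proj₁; proj₂; _,_)
open import Data.Vec using (Vec; []; _∷_; last; map; foldr)
open import Data.Vec.Relation.Unary.All using (All)
open import Relation.Nullary using (does)
open import Data.Bool using (if_then_else_)
open import Relation.Binary.PropositionalEquality using (_≡_)

Step : Set
Step = ℤ × ℤ

sumℤ : ∀ {k} → Vec ℤ k → ℤ
sumℤ = foldr _ _+_ 0ℤ

StepOK : ℕ → ℕ → Step → Set
StepOK n m (x , y) = ((1ℤ - + n) ≤ y × y ≤ 1ℤ) × (1ℤ ≤ x × x ≤ (+ m - 1ℤ))

IsLatticePath : (n m : ℕ) → Vec Step (Data.Nat.suc n) → Set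
IsLatticePath n m P =
  All (StepOK n m) P × (sumℤ (map proj₂ P) ≡ 1ℤ) × (sumℤ (map proj₁ P) ≡ + m)

nplFrom : ∀ {k} → ℤ → Vec Step k → ℤ
nplFrom s [] = 0ℤ
nplFrom s ((x , y) ∷ P) =
  (if does ((s + y) ≤? 0ℤ) then x else 0ℤ) + nplFrom (s + y) P

NPL : ∀ {k} → Vec Step k → ℤ
NPL P = nplFrom 0ℤ P

𝓛 : (n m : ℕ) → ℤ → Set
𝓛 n m r = Σ (Vec Step (Data.Nat.suc n)) λ P → IsLatticePath n m P × NPL P ≡ r

𝓛̃₀ : (n m : ℕ) → Set
𝓛̃₀ n m = Σ (Vec Step (Data.Nat.suc n)) λ P →
  (IsLatticePath n m P × NPL P ≡ 0ℤ) × proj₁ (last P) ≡ 1ℤ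

-- A path in 𝓛̃₀ has all running sums y₁ + ⋯ + yᵢ ≥ 1, so its last step (1, y) has y ≤ 0.
-- Reinsert that step at the earliest position after which the running sums stay positive:
-- the running sum at the inserted step is then non-positive and every other one is
-- positive, so NPL becomes 1. Conversely, a path with NPL = 1 and widths ≥ 1 has exactly
-- one non-positive running sum, reached by a step of width 1; moving that step to the end
-- gives back a path all of whose running sums are positive, and the two moves are inverse.
module Submission where

open import Defs
open import Axiom.UniquenessOfIdentityProofs using (module Decidable⇒UIP)
open import Data.Integer using (ℤ; +_; -[1+_]; _+_; _≤_; _≤?_; 0ℤ; 1ℤ; +≤+; -≤+)
import Data.Integer.Properties as ℤ
open import Algebra.Properties.CommutativeSemigroup ℤ.+-commutativeSemigroup
  using (x∙yz≈y∙xz; xy∙z≈xz∙y)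
import Data.Nat as ℕ
open import Data.Nat using (ℕ; zero; suc; z≤n; s≤s)
open import Data.Product using (Σ; ∃₂; _×_; _,_; proj₁; proj₂; map₁; uncurry)
open import Data.Vec using (Vec; []; _∷_; _∷ʳ_; map; init; last; initLast)
open import Data.Vec.Properties using (init-∷ʳ; last-∷ʳ)
open import Data.Vec.Relation.Unary.All as All using (All; []; _∷_)
open import Function.Bundles using (_⤖_; mk↔ₛ′)
open import Function.Properties.Inverse using (↔⇒⤖)
open import Relation.Nullary using (¬_; Dec; yes; no; contradiction)
open import Relation.Nullary.Decidable using (¬?; _×-dec_; map′; decidable-stable)
open import Relation.Nullary.Irrelevant using (Irrelevant)
open import Relation.Binary.PropositionalEquality

i+j≢0 : ∀ {i j} → 1ℤ ≤ i → 0ℤ ≤ j → i + j ≢ 0ℤ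
i+j≢0 (+≤+ (s≤s _)) (+≤+ _) ()

i+j≡1⇒j≡0 : ∀ {i j} → 1ℤ ≤ i → 0ℤ ≤ j → i + j ≡ 1ℤ → j ≡ 0ℤ
i+j≡1⇒j≡0 {+ zero}        (+≤+ ())
i+j≡1⇒j≡0 {+ suc zero}    {+ zero}  _ _ _  = refl
i+j≡1⇒j≡0 {+ suc zero}    {+ suc _} _ _ ()
i+j≡1⇒j≡0 {+ suc (suc _)} {+ _}     _ _ ()

i+j≡1⇒i≤0 : ∀ {i j} → ¬ j ≤ 0ℤ → i + j ≡ 1ℤ → i ≤ 0ℤ
i+j≡1⇒i≤0 { -[1+ _ ]} _ _ = -≤+
i+j≡1⇒i≤0 {+ zero}   _ _ = +≤+ z≤n
i+j≡1⇒i≤0 {+ suc _} {+ zero}   j≰0 _ = contradiction (+≤+ z≤n) j≰0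
i+j≡1⇒i≤0 {+ suc _} { -[1+ _ ]} j≰0 _ = contradiction -≤+ j≰0
i+j≡1⇒i≤0 {+ suc zero}    {+ suc _} _ ()
i+j≡1⇒i≤0 {+ suc (suc _)} {+ suc _} _ ()

open Decidable⇒UIP ℤ._≟_ using (≡-irrelevant)

×-irrelevant : ∀ {A B : Set} → Irrelevant A → Irrelevant B → Irrelevant (A × B)
×-irrelevant irrA irrB (a , b) (a′ , b′) = cong₂ _,_ (irrA a a′) (irrB b b′)

Σ-≡-irrelevant : ∀ {A : Set} {B : A → Set} → (∀ {a} → Irrelevant (B a)) →
                 ∀ {u v : Σ A B} → proj₁ u ≡ proj₁ v → u ≡ v
Σ-≡-irrelevant irr {_ , b} {_ , b′} refl = cong (_ ,_) (irr b b′)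

height : ∀ {k} → Vec Step k → ℤ
height P = sumℤ (map proj₂ P)

Wide : Step → Set
Wide (x , _) = 1ℤ ≤ x

data Positive : ∀ {k} → ℤ → Vec Step k → Set where
  []  : ∀ {s} → Positive s []
  _∷_ : ∀ {k s x y} {P : Vec Step k} →
        ¬ s + y ≤ 0ℤ → Positive (s + y) P → Positive s ((x , y) ∷ P)

positive? : ∀ {k} s (P : Vec Step k) → Dec (Positive s P)
positive? s []            = yes []
positive? s ((x , y) ∷ P) =
  map′ (uncurry _∷_) (λ { (p ∷ q) → p , q })
       (¬? (s + y ≤? 0ℤ) ×-dec positive? (s + y) P)

Positive-mono : ∀ {k u v} {P : Vec Step k} → u ≤ v → Positive u P → Positive v P
Positive-mono u≤v []                = []
Positive-mono u≤v (_∷_ {y = y} p q) =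
  (λ v+y≤0 → p (ℤ.≤-trans (ℤ.+-monoˡ-≤ y u≤v) v+y≤0)) ∷ Positive-mono (ℤ.+-monoˡ-≤ y u≤v) q

-- Exchanging two consecutive steps only changes the running sum between them.
Positive-swap : ∀ {k s x y cx cy} {R : Vec Step k} →
                Positive (s + y) ((cx , cy) ∷ R) → Positive (s + cy) ((x , y) ∷ R)
Positive-swap {s = s} {y = y} {cy = cy} {R} (p ∷ q) =
  subst (λ t → ¬ t ≤ 0ℤ) e p ∷ subst (λ t → Positive t R) e q
  where e = xy∙z≈xz∙y s y cy

Positive-∷ʳ⁻ : ∀ {k s c} {R : Vec Step k} → Positive s (R ∷ʳ c) → Positive s R
Positive-∷ʳ⁻ {R = []}    _       = []
Positive-∷ʳ⁻ {R = _ ∷ _} (p ∷ q) = p ∷ Positive-∷ʳ⁻ q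

Positive-∷ʳ⁺ : ∀ {k s c} {R : Vec Step k} →
               ¬ s + height (c ∷ R) ≤ 0ℤ → Positive s R → Positive s (R ∷ʳ c)
Positive-∷ʳ⁺ {s = s} {c = _ , cy} end [] =
  subst (λ t → ¬ s + t ≤ 0ℤ) (ℤ.+-identityʳ cy) end ∷ []
Positive-∷ʳ⁺ {s = s} {c = _ , cy} {(_ , y) ∷ R} end (p ∷ q) =
  p ∷ Positive-∷ʳ⁺ (subst (λ t → ¬ t ≤ 0ℤ) e end) q
  where
  e : s + (cy + (y + height R)) ≡ s + y + (cy + height R)
  e = trans (cong (_+_ s) (x∙yz≈y∙xz cy y (height R))) (sym (ℤ.+-assoc s y _))

Positive⇒end : ∀ {k s} {R : Vec Step (suc k)} → Positive s R → ¬ s + height R ≤ 0ℤ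
Positive⇒end {s = s} {(_ , y) ∷ []} (p ∷ []) =
  subst (λ t → ¬ s + t ≤ 0ℤ) (sym (ℤ.+-identityʳ y)) p
Positive⇒end {s = s} {(_ , y) ∷ _ ∷ _} (_ ∷ q) =
  subst (λ t → ¬ t ≤ 0ℤ) (ℤ.+-assoc s y _) (Positive⇒end q)

-- SingleDip s Q R c: starting from s, exactly one running sum along Q is ≤ 0, the one
-- reached by the step c, and R is Q with c removed.
data SingleDip : ∀ {k} → ℤ → Vec Step (suc k) → Vec Step k → Step → Set where
  here  : ∀ {k s x y} {P : Vec Step k} →
          s + y ≤ 0ℤ → Positive (s + y) P → SingleDip s ((x , y) ∷ P) P (x , y)
  there : ∀ {k s x y c} {P : Vec Step (suc k)} {R : Vec Step k} →
          ¬ s + y ≤ 0ℤ → SingleDip (s + y) P R c → SingleDip s ((x , y) ∷ P) ((x , y) ∷ R) c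

SingleDip-¬Positive : ∀ {k s c} {Q : Vec Step (suc k)} {R} → SingleDip s Q R c →
                      ¬ Positive s (c ∷ R)
SingleDip-¬Positive (here s+y≤0 _) (s+y≰0 ∷ _) = s+y≰0 s+y≤0
SingleDip-¬Positive {s = s} (there _ dip) (_ ∷ pos) =
  SingleDip-¬Positive dip (Positive-swap {s = s} pos)

SingleDip-Positive∷ʳ : ∀ {k s c} {Q : Vec Step (suc k)} {R} → 0ℤ ≤ s → ¬ s + height Q ≤ 0ℤ →
                       SingleDip s Q R c → Positive s (R ∷ʳ c)
SingleDip-Positive∷ʳ 0≤s end (here s+y≤0 pos) =
  Positive-∷ʳ⁺ end (Positive-mono (ℤ.≤-trans s+y≤0 0≤s) pos)
SingleDip-Positive∷ʳ {s = s} _ end (there {y = y} s+y≰0 dip) =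
  s+y≰0 ∷ SingleDip-Positive∷ʳ (ℤ.<⇒≤ (ℤ.≰⇒> s+y≰0))
                               (subst (λ t → ¬ t ≤ 0ℤ) (sym (ℤ.+-assoc s y _)) end) dip

insert : ∀ {k} → ℤ → Step → Vec Step k → Vec Step (suc k)
insert s l []                       = l ∷ []
insert s l@(_ , ly) (a@(_ , y) ∷ P) with positive? (s + ly) (a ∷ P)
... | yes _ = l ∷ a ∷ P
... | no _  = a ∷ insert (s + y) l P

extract : ∀ {k} → ℤ → Vec Step (suc k) → Vec Step k × Step
extract s (a ∷ [])            = [] , a
extract s (a@(_ , y) ∷ b ∷ P) with s + y ≤? 0ℤ
... | yes _ = b ∷ P , a
... | no _  = map₁ (a ∷_) (extract (s + y) (b ∷ P))

-- The second hypothesis says that l lands at a non-positive running sum; it survives the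
-- recursion because l only skips a step when the rest would not stay positive after it.
insert-SingleDip : ∀ {k s lx ly} {I : Vec Step k} → Positive s I →
                   (Positive (s + ly) I → s + ly ≤ 0ℤ) →
                   SingleDip s (insert s (lx , ly) I) I (lx , ly)
insert-SingleDip [] landing = here (landing []) []
insert-SingleDip {s = s} {lx} {ly} {(x , y) ∷ I} (s+y≰0 ∷ pos) landing
  with positive? (s + ly) ((x , y) ∷ I)
... | yes pos′ = here (landing pos′) pos′
... | no ¬pos′ = there s+y≰0 (insert-SingleDip pos landing′)
  where
  landing′ : Positive (s + y + ly) I → s + y + ly ≤ 0ℤ
  landing′ pos″ = decidable-stable (s + y + ly ≤? 0ℤ)
                    (λ s+y+ly≰0 → ¬pos′ (Positive-swap {s = s} {cx = lx} (s+y+ly≰0 ∷ pos″)))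

SingleDip-insert : ∀ {k s c} {Q : Vec Step (suc k)} {R} → SingleDip s Q R c → insert s c R ≡ Q
SingleDip-insert (here {P = []} _ _) = refl
SingleDip-insert (here {s = s} {y = y} {P = a ∷ P} _ pos) with positive? (s + y) (a ∷ P)
... | yes _   = refl
... | no ¬pos = contradiction pos ¬pos
SingleDip-insert (there {s = s} {x} {y} {c = _ , cy} {R = R} _ dip)
  with positive? (s + cy) ((x , y) ∷ R)
... | yes pos = contradiction (Positive-swap {s = s} pos) (SingleDip-¬Positive dip)
... | no _    = cong ((x , y) ∷_) (SingleDip-insert dip)

SingleDip-extract : ∀ {k s c} {Q : Vec Step (suc k)} {R} → SingleDip s Q R c →
                    extract s Q ≡ (R , c)
SingleDip-extract (here {P = []} _ _) = refl
SingleDip-extract (here {s = s} {y = y} {P = _ ∷ _} s+y≤0 _) with s + y ≤? 0ℤ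
... | yes _     = refl
... | no s+y≰0  = contradiction s+y≤0 s+y≰0
SingleDip-extract (there {s = s} {x} {y} {P = _ ∷ _} s+y≰0 dip) with s + y ≤? 0ℤ
... | yes s+y≤0 = contradiction s+y≤0 s+y≰0
... | no _      = cong (map₁ ((x , y) ∷_)) (SingleDip-extract dip)

npl-nonneg : ∀ {k s} {P : Vec Step k} → All Wide P → 0ℤ ≤ nplFrom s P
npl-nonneg [] = ℤ.≤-refl
npl-nonneg {s = s} {(_ , y) ∷ _} (1≤x ∷ wide) with s + y ≤? 0ℤ
... | yes _ = ℤ.+-mono-≤ (ℤ.≤-trans (+≤+ z≤n) 1≤x) (npl-nonneg wide)
... | no _  = ℤ.+-mono-≤ (ℤ.≤-refl {0ℤ}) (npl-nonneg wide)

Positive⇒npl≡0 : ∀ {k s} {P : Vec Step k} → Positive s P → nplFrom s P ≡ 0ℤ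
Positive⇒npl≡0 [] = refl
Positive⇒npl≡0 {s = s} {(_ , y) ∷ _} (s+y≰0 ∷ pos) with s + y ≤? 0ℤ
... | yes s+y≤0 = contradiction s+y≤0 s+y≰0
... | no _      = trans (ℤ.+-identityˡ _) (Positive⇒npl≡0 pos)

npl≡0⇒Positive : ∀ {k s} {P : Vec Step k} → All Wide P → nplFrom s P ≡ 0ℤ → Positive s P
npl≡0⇒Positive [] _ = []
npl≡0⇒Positive {s = s} {(_ , y) ∷ _} (1≤x ∷ wide) npl≡0 with s + y ≤? 0ℤ
... | yes _     = contradiction npl≡0 (i+j≢0 1≤x (npl-nonneg wide))
... | no s+y≰0  = s+y≰0 ∷ npl≡0⇒Positive wide (trans (sym (ℤ.+-identityˡ _)) npl≡0)

SingleDip-npl : ∀ {k s c} {Q : Vec Step (suc k)} {R} → SingleDip s Q R c →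
                nplFrom s Q ≡ proj₁ c
SingleDip-npl (here {s = s} {x} {y} s+y≤0 pos) with s + y ≤? 0ℤ
... | yes _     = trans (cong (_+_ x) (Positive⇒npl≡0 pos)) (ℤ.+-identityʳ x)
... | no s+y≰0  = contradiction s+y≤0 s+y≰0
SingleDip-npl (there {s = s} {y = y} s+y≰0 dip) with s + y ≤? 0ℤ
... | yes s+y≤0 = contradiction s+y≤0 s+y≰0
... | no _      = trans (ℤ.+-identityˡ _) (SingleDip-npl dip)

npl≡1⇒SingleDip : ∀ {k s} {Q : Vec Step (suc k)} → All Wide Q → nplFrom s Q ≡ 1ℤ →
                  ∃₂ (SingleDip s Q)
npl≡1⇒SingleDip {s = s} {(x , y) ∷ P} (1≤x ∷ wide) npl≡1 with s + y ≤? 0ℤ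
... | yes s+y≤0 =
  P , (x , y) , here s+y≤0 (npl≡0⇒Positive wide (i+j≡1⇒j≡0 1≤x (npl-nonneg wide) npl≡1))
npl≡1⇒SingleDip {s = s} {(x , y) ∷ _ ∷ _} (_ ∷ wide) npl≡1 | no s+y≰0 =
  let R , c , dip = npl≡1⇒SingleDip wide (trans (sym (ℤ.+-identityˡ _)) npl≡1)
  in (x , y) ∷ R , c , there s+y≰0 dip

sum-∷ʳ : ∀ (f : Step → ℤ) {k c} (R : Vec Step k) →
         sumℤ (map f (R ∷ʳ c)) ≡ f c + sumℤ (map f R)
sum-∷ʳ f []      = refl
sum-∷ʳ f {c = c} (a ∷ R) = trans (cong (_+_ (f a)) (sum-∷ʳ f R)) (x∙yz≈y∙xz (f a) (f c) _)

SingleDip-sum : ∀ (f : Step → ℤ) {k s c} {Q : Vec Step (suc k)} {R} → SingleDip s Q R c →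
                sumℤ (map f Q) ≡ sumℤ (map f (R ∷ʳ c))
SingleDip-sum f {R = R} dip = trans (sum-cons dip) (sym (sum-∷ʳ f R))
  where
  sum-cons : ∀ {k s c} {Q : Vec Step (suc k)} {R} → SingleDip s Q R c →
             sumℤ (map f Q) ≡ f c + sumℤ (map f R)
  sum-cons (here _ _) = refl
  sum-cons (there {x = x} {y} {c} _ dip) =
    trans (cong (_+_ (f (x , y))) (sum-cons dip)) (x∙yz≈y∙xz (f (x , y)) (f c) _)

module _ {Pr : Step → Set} where

  All-∷ʳ⁺ : ∀ {k c} {R : Vec Step k} → All Pr R → Pr c → All Pr (R ∷ʳ c)
  All-∷ʳ⁺ []         pc = pc ∷ []
  All-∷ʳ⁺ (pa ∷ pR) pc = pa ∷ All-∷ʳ⁺ pR pc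

  All-∷ʳ⁻ : ∀ {k c} {R : Vec Step k} → All Pr (R ∷ʳ c) → All Pr R × Pr c
  All-∷ʳ⁻ {R = []}    (pc ∷ [])  = [] , pc
  All-∷ʳ⁻ {R = _ ∷ _} (pa ∷ pRc) = map₁ (pa ∷_) (All-∷ʳ⁻ pRc)

  SingleDip-All⁺ : ∀ {k s c} {Q : Vec Step (suc k)} {R} → SingleDip s Q R c →
                   All Pr (R ∷ʳ c) → All Pr Q
  SingleDip-All⁺ (here _ _) pRc with All-∷ʳ⁻ pRc
  ... | pR , pc = pc ∷ pR
  SingleDip-All⁺ (there _ dip) (pa ∷ pRc) = pa ∷ SingleDip-All⁺ dip pRc

  SingleDip-All⁻ : ∀ {k s c} {Q : Vec Step (suc k)} {R} → SingleDip s Q R c →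
                   All Pr Q → All Pr (R ∷ʳ c)
  SingleDip-All⁻ (here _ _)    (pc ∷ pR) = All-∷ʳ⁺ pR pc
  SingleDip-All⁻ (there _ dip) (pa ∷ pQ) = pa ∷ SingleDip-All⁻ dip pQ

module _ {n m : ℕ} where

  SingleDip-IsLatticePath⁺ : ∀ {s c} {Q : Vec Step (suc n)} {R} → SingleDip s Q R c →
                             IsLatticePath n m (R ∷ʳ c) → IsLatticePath n m Q
  SingleDip-IsLatticePath⁺ dip (ok , ys , xs) =
    SingleDip-All⁺ dip ok ,
    trans (SingleDip-sum proj₂ dip) ys , trans (SingleDip-sum proj₁ dip) xs

  SingleDip-IsLatticePath⁻ : ∀ {s c} {Q : Vec Step (suc n)} {R} → SingleDip s Q R c →
                             IsLatticePath n m Q → IsLatticePath n m (R ∷ʳ c)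
  SingleDip-IsLatticePath⁻ dip (ok , ys , xs) =
    SingleDip-All⁻ dip ok ,
    trans (sym (SingleDip-sum proj₂ dip)) ys , trans (sym (SingleDip-sum proj₁ dip)) xs

  widths : ∀ {P : Vec Step (suc n)} → IsLatticePath n m P → All Wide P
  widths (ok , _) = All.map (λ okₐ → proj₁ (proj₂ okₐ)) ok

  IsLatticePath-irrelevant : ∀ {P : Vec Step (suc n)} → Irrelevant (IsLatticePath n m P)
  IsLatticePath-irrelevant =
    ×-irrelevant (All.irrelevant (×-irrelevant (×-irrelevant ℤ.≤-irrelevant ℤ.≤-irrelevant)
                                               (×-irrelevant ℤ.≤-irrelevant ℤ.≤-irrelevant)))
                 (×-irrelevant ≡-irrelevant ≡-irrelevant)

moveLastToDip : ∀ {k} → Vec Step (suc k) → Vec Step (suc k)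
moveLastToDip P = insert 0ℤ (last P) (init P)

moveDipToLast : ∀ {k} → Vec Step (suc k) → Vec Step (suc k)
moveDipToLast Q = uncurry _∷ʳ_ (extract 0ℤ Q)

init∷ʳlast : ∀ {k} (P : Vec Step (suc k)) → P ≡ init P ∷ʳ last P
init∷ʳlast P = proj₂ (proj₂ (initLast P))

module _ {n m : ℕ} where

  moveLastToDip-SingleDip : ∀ (P : Vec Step (suc (suc n))) → IsLatticePath (suc n) m P →
                            NPL P ≡ 0ℤ → SingleDip 0ℤ (moveLastToDip P) (init P) (last P)
  moveLastToDip-SingleDip P path@(_ , ys , _) npl≡0 =
    insert-SingleDip (Positive-∷ʳ⁻ pos) (λ _ → subst (_≤ 0ℤ) (sym (ℤ.+-identityˡ _)) ly≤0)
    where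
    pos : Positive 0ℤ (init P ∷ʳ last P)
    pos = subst (Positive 0ℤ) (init∷ʳlast P) (npl≡0⇒Positive (widths path) npl≡0)
    ly≤0 : proj₂ (last P) ≤ 0ℤ
    ly≤0 = i+j≡1⇒i≤0
      (subst (λ t → ¬ t ≤ 0ℤ) (ℤ.+-identityˡ _) (Positive⇒end (Positive-∷ʳ⁻ pos)))
      (trans (sym (sum-∷ʳ proj₂ (init P))) (trans (cong height (sym (init∷ʳlast P))) ys))

  moveDipToLast-SingleDip : ∀ {Q : Vec Step (suc (suc n))} → IsLatticePath (suc n) m Q → NPL Q ≡ 1ℤ →
                      SingleDip 0ℤ Q (proj₁ (extract 0ℤ Q)) (proj₂ (extract 0ℤ Q))
  moveDipToLast-SingleDip {Q} path npl≡1 =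
    let R , c , dip = npl≡1⇒SingleDip (widths path) npl≡1
    in subst (uncurry (SingleDip 0ℤ Q)) (sym (SingleDip-extract dip)) dip

  lastToDip : 𝓛̃₀ (suc n) m → 𝓛 (suc n) m (+ 1)
  lastToDip (P , (path , npl≡0) , last≡1) =
    moveLastToDip P ,
    SingleDip-IsLatticePath⁺ dip (subst (IsLatticePath (suc n) m) (init∷ʳlast P) path) ,
    trans (SingleDip-npl dip) last≡1
    where dip = moveLastToDip-SingleDip P path npl≡0

  dipToLast : 𝓛 (suc n) m (+ 1) → 𝓛̃₀ (suc n) m
  dipToLast (Q , path@(_ , ys , _) , npl≡1) =
    moveDipToLast Q ,
    (SingleDip-IsLatticePath⁻ dip path , Positive⇒npl≡0 (SingleDip-Positive∷ʳ ℤ.≤-refl end dip)) ,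
    trans (cong proj₁ (last-∷ʳ c R)) (trans (sym (SingleDip-npl dip)) npl≡1)
    where
    R = proj₁ (extract 0ℤ Q)
    c = proj₂ (extract 0ℤ Q)
    dip = moveDipToLast-SingleDip path npl≡1
    end : ¬ 0ℤ + height Q ≤ 0ℤ
    end = subst (λ t → ¬ t ≤ 0ℤ) (sym (trans (ℤ.+-identityˡ _) ys)) λ { (+≤+ ()) }

  dipToLast∘lastToDip : ∀ P → dipToLast (lastToDip P) ≡ P
  dipToLast∘lastToDip (P , (path , npl≡0) , _) =
    Σ-≡-irrelevant (×-irrelevant (×-irrelevant IsLatticePath-irrelevant ≡-irrelevant) ≡-irrelevant)
      (trans (cong (uncurry _∷ʳ_) (SingleDip-extract dip)) (sym (init∷ʳlast P)))
    where dip = moveLastToDip-SingleDip P path npl≡0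

  lastToDip∘dipToLast : ∀ Q → lastToDip (dipToLast Q) ≡ Q
  lastToDip∘dipToLast (Q , path , npl≡1) =
    Σ-≡-irrelevant (×-irrelevant IsLatticePath-irrelevant ≡-irrelevant) (begin
      insert 0ℤ (last (R ∷ʳ c)) (init (R ∷ʳ c))
        ≡⟨ cong₂ (insert 0ℤ) (last-∷ʳ c R) (init-∷ʳ c R) ⟩
      insert 0ℤ c R
        ≡⟨ SingleDip-insert (moveDipToLast-SingleDip path npl≡1) ⟩
      Q ∎)
    where
    open ≡-Reasoning
    R = proj₁ (extract 0ℤ Q)
    c = proj₂ (extract 0ℤ Q)

lemma2p6 : (n m : ℕ) → 1 ℕ.≤ n → suc n ℕ.≤ m → 𝓛̃₀ n m ⤖ 𝓛 n m (+ 1)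
lemma2p6 (suc n) m _ _ = ↔⇒⤖ (mk↔ₛ′ lastToDip dipToLast lastToDip∘dipToLast dipToLast∘lastToDip)
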